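{- Let $d\ge 2$, $n\ge d$ and $k\ge 1$ be integers. Then $D=\{0,1,\dots,\lceil n/(d^k+d^{k-1})\rceil-1\}$ is a distance $k$-dominating set of the generalized Kautz digraph $G_K(n,d)$, and consequently $$\gamma_k(G_K(n,d))\le \left\lceil \frac{n}{d^k+d^{k-1}}\right\rceil.$$
   Context: The generalized Kautz digraph $G_K(n,d)$ has vertex set $\{0,1,\dots,n-1\}$ and an arc $(x,y)$ whenever $y\equiv -dx-i \pmod n$ for some $1\le i\le d$ (self-loops allowed, no multiple arcs). A set $D$ of vertices of a digraph $G$ is a distance $k$-dominating set if every vertex $v\notin D$ has some $u\in D$ with a directed path from $u$ to $v$ of length at most $k$. $\gamma_k(G)$ denotes the minimum cardinality of a distance $k$-dominating set of $G$. -}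

module Defs where

open import Data.Nat using (ℕ; zero; suc; _+_; _*_; _∸_; _^_; _≤_; _<_; NonZero)
open import Data.Nat.Divisibility using (_∣_)
open import Data.Nat.DivMod using (_/_)
open import Data.Fin using (Fin; toℕ)
open import Data.Fin.Subset using (Subset; _∈_; _∉_; ∣_∣)
open import Data.Product using (Σ; ∃; _×_)
open import Relation.Binary.PropositionalEquality using (_≡_)

-- Arc relation of the generalized Kautz digraph G_K(n,d) on vertices Fin n:
-- (x,y) is an arc iff y ≡ -d x - i (mod n) for some 1 ≤ i ≤ d,
-- i.e. n divides y + d x + i.
KautzArc : (n d : ℕ) → Fin n → Fin n → Set
KautzArc n d x y = ∃ λ i → (1 ≤ i) × (i ≤ d) × (n ∣ (toℕ y + d * toℕ x + i))

data Walk {n : ℕ} (E : Fin n → Fin n → Set) : ℕ → Fin n → Fin n → Set where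
  here : ∀ {u} → Walk E 0 u u
  step : ∀ {ℓ u w v} → E u w → Walk E ℓ w v → Walk E (suc ℓ) u v

-- Directed path (walk) from u to v of length at most k.
-- (A shortest walk is a path, so walks suffice.)
WithinDist : {n : ℕ} (E : Fin n → Fin n → Set) → ℕ → Fin n → Fin n → Set
WithinDist E k u v = ∃ λ ℓ → (ℓ ≤ k) × Walk E ℓ u v

IsDistDom : {n : ℕ} (E : Fin n → Fin n → Set) → ℕ → Subset n → Set
IsDistDom {n} E k D = (v : Fin n) → v ∉ D → Σ (Fin n) λ u → (u ∈ D) × WithinDist E k u v

-- γ_k(G) ≤ c  iff some distance k-dominating set has cardinality ≤ c.
γ≤ : {n : ℕ} (E : Fin n → Fin n → Set) → ℕ → ℕ → Set
γ≤ {n} E k c = Σ (Subset n) λ D → IsDistDom E k D × (∣ D ∣ ≤ c)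

⌈_/_⌉ : (a b : ℕ) → .{{NonZero b}} → ℕ
⌈ a / b ⌉ = (a + b ∸ 1) / b

InInitSeg : {n : ℕ} → ℕ → Subset n → Set
InInitSeg {n} m D = (v : Fin n) → (v ∈ D → toℕ v < m) × (toℕ v < m → v ∈ D)

{-# OPTIONS --safe #-}
module Submission where

-- For v = r + q·d with r < d, the Kautz arcs q → n ∸ 1 ∸ v (take i = r + 1) and
-- n ∸ 1 ∸ q → v (take i = d ∸ r) show that every vertex among the last d·a has an
-- in-neighbour among the first a, and every vertex among the first d·a has one among the
-- last a. Starting from D = {0, …, m ∸ 1}, the vertices reached from D by walks of length
-- exactly j therefore contain a segment of d^j·m vertices at one end, the ends alternating
-- with j. For k = j + 1 the segments reached after j and after k steps lie at opposite ends
-- and have sizes d^(k∸1)·m and d^k·m, so they cover all n vertices once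
-- n ≤ (d^k + d^(k∸1))·m, which m = ⌈n/(d^k + d^(k∸1))⌉ guarantees.

open import Defs
open import Data.Nat using (ℕ; zero; suc; _+_; _*_; _∸_; _^_; _≤_; _<_; z≤n; s≤s; z<s; _<?_; NonZero)
open import Data.Nat.Properties
open import Data.Nat.DivMod using (_/_; _%_; /-congˡ; m≡m%n+[m/n]*n; m%n<n; m/n≤m; m<n*o⇒m/o<n)
open import Data.Nat.Divisibility using (divides)
open import Data.Nat.Tactic.RingSolver using (solve-∀)
open import Data.Fin as Fin using (Fin; toℕ; fromℕ<)
open import Data.Fin.Properties using (toℕ<n; toℕ-fromℕ<)
open import Data.Fin.Subset using (Subset; inside; outside; _∈_; ∣_∣)
open import Data.Vec using (_∷_; []; here; there)
open import Data.Product using (Σ; ∃; _×_; _,_; proj₂)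
open import Data.Sum using (_⊎_; inj₁; inj₂; [_,_])
open import Function using (_∘_)
open import Relation.Nullary using (yes; no)
open import Relation.Binary.PropositionalEquality
  using (_≡_; sym; trans; cong; subst; module ≡-Reasoning)

m≤n*⌈m/n⌉ : ∀ m n .{{_ : NonZero n}} → m ≤ n * ⌈ m / n ⌉
m≤n*⌈m/n⌉ m n@(suc n-1) = +-cancelʳ-≤ n-1 m (n * q) (begin
  m + n-1                  ≡⟨ m≡m%n+[m/n]*n (m + n-1) n ⟩
  (m + n-1) % n + q′ * n   ≤⟨ +-monoˡ-≤ (q′ * n) (≤-pred (m%n<n (m + n-1) n)) ⟩
  n-1 + q′ * n             ≡⟨ +-comm n-1 (q′ * n) ⟩
  q′ * n + n-1             ≡⟨ cong (λ t → t * n + n-1) q′≡q ⟩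
  q * n + n-1              ≡⟨ cong (_+ n-1) (*-comm q n) ⟩
  n * q + n-1              ∎)
  where
  open ≤-Reasoning
  q = ⌈ m / n ⌉
  q′ = (m + n-1) / n
  q′≡q : q′ ≡ q
  q′≡q = /-congˡ (cong (_∸ 1) (sym (+-suc m n-1)))

walk-snoc : ∀ {n} {E : Fin n → Fin n → Set} {ℓ u w v} → Walk E ℓ u w → E w v → Walk E (suc ℓ) u v
walk-snoc here         e = step e here
walk-snoc (step e′ p)  e = step e′ (walk-snoc p e)

module _ {n : ℕ} (E : Fin n → Fin n → Set) (D : Subset n) where

  ReachedIn : ℕ → Fin n → Set
  ReachedIn ℓ v = Σ (Fin n) λ u → u ∈ D × Walk E ℓ u v

  reachedIn-extend : ∀ {ℓ w v} → ReachedIn ℓ w → E w v → ReachedIn (suc ℓ) v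
  reachedIn-extend (u , u∈D , p) e = u , u∈D , walk-snoc p e

  reachedIn⇒withinDist : ∀ {ℓ k v} → ℓ ≤ k → ReachedIn ℓ v →
                         Σ (Fin n) λ u → u ∈ D × WithinDist E k u v
  reachedIn⇒withinDist {ℓ} ℓ≤k (u , u∈D , p) = u , u∈D , ℓ , ℓ≤k , p

data Side : Set where
  lower upper : Side

opposite : Side → Side
opposite lower = upper
opposite upper = lower

-- upper a consists of the last a vertices n ∸ a, …, n ∸ 1, stated without truncated subtraction.
Segment : (n : ℕ) → Side → ℕ → Fin n → Set
Segment n lower a v = toℕ v < a
Segment n upper a v = n ≤ toℕ v + a

segments-cover : ∀ {n a b} s (v : Fin n) → n ≤ a + b →
                 Segment n s a v ⊎ Segment n (opposite s) b v
segments-cover {n} {a} {b} lower v n≤a+b with toℕ v <? a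
... | yes v<a = inj₁ v<a
... | no  v≮a = inj₂ (≤-trans n≤a+b (+-monoˡ-≤ b (≮⇒≥ v≮a)))
segments-cover {n} {a} {b} upper v n≤a+b with segments-cover lower v (subst (n ≤_) (+-comm a b) n≤a+b)
... | inj₁ v∈lower = inj₂ v∈lower
... | inj₂ v∈upper = inj₁ v∈upper

module _ {n d : ℕ} .{{_ : NonZero d}} where

  kautz-upper-has-lower-pred : ∀ {a} (v : Fin n) → Segment n upper (d * a) v →
                               ∃ λ w → Segment n lower a w × KautzArc n d w v
  kautz-upper-has-lower-pred {a} v n≤v+da = w , w<a , suc r , s≤s z≤n , m%n<n s d , divides 1 sum≡n
    where
    open ≡-Reasoning
    x = toℕ v
    s = n ∸ suc x
    q = s / d
    r = s % d
    x+1+s≡n : suc x + s ≡ n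
    x+1+s≡n = m+[n∸m]≡n (toℕ<n v)
    s<da : s < d * a
    s<da = +-cancelˡ-≤ x (suc s) (d * a)
             (≤-trans (≤-reflexive (trans (+-suc x s) x+1+s≡n)) n≤v+da)
    q<n : q < n
    q<n = ≤-<-trans (m/n≤m s d) (∸-monoʳ-< z<s (toℕ<n v))
    w : Fin n
    w = fromℕ< q<n
    w<a : toℕ w < a
    w<a = subst (_< a) (sym (toℕ-fromℕ< q<n)) (m<n*o⇒m/o<n (subst (s <_) (*-comm d a) s<da))
    sum≡n : x + d * toℕ w + suc r ≡ 1 * n
    sum≡n = begin
      x + d * toℕ w + suc r   ≡⟨ cong (λ t → x + d * t + suc r) (toℕ-fromℕ< q<n) ⟩
      x + d * q + suc r       ≡⟨ regroup x d q r ⟩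
      suc x + (r + q * d)     ≡⟨ cong (suc x +_) (m≡m%n+[m/n]*n s d) ⟨
      suc x + s               ≡⟨ x+1+s≡n ⟩
      n                       ≡⟨ +-identityʳ n ⟨
      1 * n                   ∎
      where
      regroup : ∀ x d q r → x + d * q + suc r ≡ suc x + (r + q * d)
      regroup = solve-∀

  kautz-lower-has-upper-pred : ∀ {a} (v : Fin n) → Segment n lower (d * a) v →
                               ∃ λ w → Segment n upper a w × KautzArc n d w v
  kautz-lower-has-upper-pred {a} v v<da = w , n≤w+a , d ∸ r , m<n⇒0<n∸m r<d , m∸n≤m d r , divides d sum≡dn
    where
    open ≡-Reasoning
    x = toℕ v
    q = x / d
    r = x % d
    r<d : r < d
    r<d = m%n<n x d
    q<a : q < a
    q<a = m<n*o⇒m/o<n (subst (x <_) (*-comm d a) v<da)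
    q<n : q < n
    q<n = ≤-<-trans (m/n≤m x d) (toℕ<n v)
    y = n ∸ suc q
    y+1+q≡n : y + suc q ≡ n
    y+1+q≡n = m∸n+n≡m q<n
    w : Fin n
    w = fromℕ< (∸-monoʳ-< z<s q<n)
    w≡y : toℕ w ≡ y
    w≡y = toℕ-fromℕ< (∸-monoʳ-< z<s q<n)
    n≤w+a : n ≤ toℕ w + a
    n≤w+a = subst (λ t → n ≤ t + a) (sym w≡y) (subst (_≤ y + a) y+1+q≡n (+-monoʳ-≤ y q<a))
    sum≡dn : x + d * toℕ w + (d ∸ r) ≡ d * n
    sum≡dn = begin
      x + d * toℕ w + (d ∸ r)            ≡⟨ cong (λ t → x + d * t + (d ∸ r)) w≡y ⟩
      x + d * y + (d ∸ r)                ≡⟨ cong (λ t → t + d * y + (d ∸ r)) (m≡m%n+[m/n]*n x d) ⟩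
      r + q * d + d * y + (d ∸ r)        ≡⟨ regroup r q d y (d ∸ r) ⟩
      (r + (d ∸ r)) + d * (y + q)        ≡⟨ cong (_+ d * (y + q)) (m+[n∸m]≡n (<⇒≤ r<d)) ⟩
      d + d * (y + q)                    ≡⟨ regroup′ d y q ⟩
      d * (y + suc q)                    ≡⟨ cong (d *_) y+1+q≡n ⟩
      d * n                              ∎
      where
      regroup : ∀ r q d y e → r + q * d + d * y + e ≡ (r + e) + d * (y + q)
      regroup = solve-∀
      regroup′ : ∀ d y q → d + d * (y + q) ≡ d * (y + suc q)
      regroup′ = solve-∀

  kautz-segment-pred : ∀ s {a} (v : Fin n) → Segment n (opposite s) (d * a) v →
                       ∃ λ w → Segment n s a w × KautzArc n d w v
  kautz-segment-pred lower = kautz-upper-has-lower-pred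
  kautz-segment-pred upper = kautz-lower-has-upper-pred

SegmentReachedIn : ∀ {n} (E : Fin n → Fin n → Set) (D : Subset n) → Side → ℕ → ℕ → Set
SegmentReachedIn {n} E D s ℓ a = ∀ v → Segment n s a v → ReachedIn E D ℓ v

sideAt : ℕ → Side
sideAt zero    = lower
sideAt (suc ℓ) = opposite (sideAt ℓ)

module _ {n d : ℕ} .{{_ : NonZero d}} {D : Subset n} where

  private
    Reached : Side → ℕ → ℕ → Set
    Reached = SegmentReachedIn (KautzArc n d) D

  kautz-segmentReached-suc : ∀ s {ℓ a} → Reached s ℓ a → Reached (opposite s) (suc ℓ) (d * a)
  kautz-segmentReached-suc s reached v v∈seg with kautz-segment-pred s v v∈seg
  ... | w , w∈seg , arc = reachedIn-extend _ D (reached w w∈seg) arc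

  kautz-segmentReached-sideAt : ∀ {a} → Reached lower 0 a → ∀ ℓ → Reached (sideAt ℓ) ℓ (d ^ ℓ * a)
  kautz-segmentReached-sideAt {a} reached zero =
    subst (Reached lower 0) (sym (*-identityˡ a)) reached
  kautz-segmentReached-sideAt {a} reached (suc ℓ) =
    subst (Reached (sideAt (suc ℓ)) (suc ℓ)) (sym (*-assoc d (d ^ ℓ) a))
      (kautz-segmentReached-suc (sideAt ℓ) (kautz-segmentReached-sideAt reached ℓ))

  kautz-lowerSegment-distDom : ∀ m ℓ → (∀ v → toℕ v < m → v ∈ D) →
                               n ≤ (d ^ suc ℓ + d ^ ℓ) * m → IsDistDom (KautzArc n d) (suc ℓ) D
  kautz-lowerSegment-distDom m ℓ lower⊆D n≤[dˡ⁺¹+dˡ]m v _ =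
    [ reachedIn⇒withinDist _ D (n≤1+n ℓ) ∘ reached ℓ v
    , reachedIn⇒withinDist _ D ≤-refl ∘ reached (suc ℓ) v
    ] (segments-cover (sideAt ℓ) v n≤dˡm+dˡ⁺¹m)
    where
    reached : ∀ j → SegmentReachedIn (KautzArc n d) D (sideAt j) j (d ^ j * m)
    reached = kautz-segmentReached-sideAt (λ u u<m → u , lower⊆D u u<m , here)
    n≤dˡm+dˡ⁺¹m : n ≤ d ^ ℓ * m + d ^ suc ℓ * m
    n≤dˡm+dˡ⁺¹m = subst (n ≤_)
      (trans (*-distribʳ-+ m (d ^ suc ℓ) (d ^ ℓ)) (+-comm (d ^ suc ℓ * m) (d ^ ℓ * m)))
      n≤[dˡ⁺¹+dˡ]m

initialSegment : (n m : ℕ) → Subset n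
initialSegment zero    m       = []
initialSegment (suc n) zero    = outside ∷ initialSegment n zero
initialSegment (suc n) (suc m) = inside  ∷ initialSegment n m

∣initialSegment∣≤ : ∀ n m → ∣ initialSegment n m ∣ ≤ m
∣initialSegment∣≤ zero    m       = z≤n
∣initialSegment∣≤ (suc n) zero    = ∣initialSegment∣≤ n zero
∣initialSegment∣≤ (suc n) (suc m) = s≤s (∣initialSegment∣≤ n m)

∈initialSegment⇒< : ∀ {n m} (v : Fin n) → v ∈ initialSegment n m → toℕ v < m
∈initialSegment⇒< {suc n} {suc m} Fin.zero    here      = s≤s z≤n
∈initialSegment⇒< {suc n} {suc m} (Fin.suc v) (there p) = s≤s (∈initialSegment⇒< v p)
∈initialSegment⇒< {suc n} {zero}  (Fin.suc v) (there p) with () ← ∈initialSegment⇒< v p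

<⇒∈initialSegment : ∀ {n m} (v : Fin n) → toℕ v < m → v ∈ initialSegment n m
<⇒∈initialSegment {suc n} {suc m} Fin.zero    _         = here
<⇒∈initialSegment {suc n} {suc m} (Fin.suc v) (s≤s v<m) = there (<⇒∈initialSegment v v<m)

initialSegment-inInitSeg : ∀ n m → InInitSeg m (initialSegment n m)
initialSegment-inInitSeg n m v = ∈initialSegment⇒< v , <⇒∈initialSegment v

theorem3p1 : (n d k : ℕ) → 2 ≤ d → d ≤ n → 1 ≤ k →
    {{_ : NonZero (d ^ k + d ^ (k ∸ 1))}} →
    ((D : Subset n) → InInitSeg ⌈ n / d ^ k + d ^ (k ∸ 1) ⌉ D → IsDistDom (KautzArc n d) k D)
    × γ≤ (KautzArc n d) k ⌈ n / d ^ k + d ^ (k ∸ 1) ⌉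
theorem3p1 n d@(suc _) (suc ℓ) _ _ _ =
  dominates , initialSegment n M , dominates _ (initialSegment-inInitSeg n M) , ∣initialSegment∣≤ n M
  where
  M : ℕ
  M = ⌈ n / d ^ suc ℓ + d ^ ℓ ⌉
  dominates : (D : Subset n) → InInitSeg M D → IsDistDom (KautzArc n d) (suc ℓ) D
  dominates D D≡lower =
    kautz-lowerSegment-distDom M ℓ (λ v → proj₂ (D≡lower v)) (m≤n*⌈m/n⌉ n (d ^ suc ℓ + d ^ ℓ))
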